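{- Let $\operatorname{ch}_1,\operatorname{ch}_2$ be maximal chains of $\mathcal{O}_{d+1}$ that differ in exactly one element, say $\mathcal{T}\in\operatorname{ch}_1\setminus\operatorname{ch}_2$ and $\mathcal{T}'\in\operatorname{ch}_2\setminus\operatorname{ch}_1$, both of rank $r$ with $0\le r<d$. Let $(\pi_i,\tau_i)\in\mathfrak{S}_{d+1}\times\mathfrak{S}_d$ be the unique pairs with $\operatorname{ch}_i=\operatorname{ch}(\pi_i,\tau_i)$, $i=1,2$. Then: (1) If $0<r<d$, then $\pi_1=\pi_2$ and $(r,r+1)\circ\tau_1=\tau_2$, where $(r,r+1)$ is the transposition exchanging $r$ and $r+1$ (and the two chains form a diamond: they share all elements other than $\mathcal{T},\mathcal{T}'$, in particular their minimum). (2) If $r=0$, let $\mathcal{T}_1$ be the common rank-$1$ element of the two chains, written $\mathcal{T}_1=s_1|s_2|\cdots|s_{i-1}|s_is_i'|s_{i+1}|\cdots|s_d$ (its unique $2$-element block in position $i$). Then $\tau_1=\tau_2$, $\tau_1(i)=1=\tau_2(i)$, and $(i,i+1)\circ\pi_1=\pi_2$. Moreover, if pairs $(\pi_1,\tau_1),(\pi_2,\tau_2)$ satisfy either [$\pi_1=\pi_2$ and $(r,r+1)\circ\tau_1=\tau_2$ for some $1\le r<d$] or [$\tau_1=\tau_2$, $\tau_1(i)=1$ and $(i,i+1)\circ\pi_1=\pi_2$ for some $i$], then $\operatorname{ch}(\pi_1,\tau_1)$ and $\operatorname{ch}(\pi_2,\tau_2)$ are maximal chains of $\mathcal{O}_{d+1}$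 differing in exactly one element.
   Context: $\mathcal{O}_{d+1}$ is the poset of ordered set partitions $S_1|\cdots|S_k$ of $[d+1]$ ordered by refinement (merging consecutive blocks goes up), ranked by $(d+1)-\#\text{blocks}$, with maximum $([d+1])$ of rank $d$. For $(\pi,\tau)\in\mathfrak{S}_{d+1}\times\mathfrak{S}_d$, consider the sequence $\pi^{ -1}(1),\dots,\pi^{ -1}(d+1)$ with a bar between $\pi^{ -1}(j)$ and $\pi^{ -1}(j+1)$ labelled $\tau(j)$; for $0\le r\le d$, $\mathcal{T}(\pi,\tau;r)$ is the ordered set partition obtained by deleting the bars with labels $\le r$; $\operatorname{ch}(\pi,\tau)=\{\mathcal{T}(\pi,\tau;r):0\le r\le d\}$. Every maximal chain of $\mathcal{O}_{d+1}$ equals $\operatorname{ch}(\pi,\tau)$ for a unique $(\pi,\tau)$. Permutations are composed as functions, e.g. $((i,i+1)\circ\pi)(x)=(i,i+1)(\pi(x))$. -}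

module Defs where

open import Data.Nat using (ℕ; zero; suc; _∸_; _≤_; _<_; _⊔_; _<ᵇ_; _+_; _≡ᵇ_)
open import Data.Bool using (Bool; true; false; if_then_else_; _∧_)
open import Data.Fin using (Fin; toℕ)
import Data.Fin as F
open import Data.Fin.Permutation using (Permutation′; _⟨$⟩ʳ_)
open import Data.Product using (Σ; _×_; _,_)
open import Data.Sum using (_⊎_)
open import Relation.Nullary using (¬_)
open import Relation.Binary.PropositionalEquality using (_≡_)

-- Conventions: [n] = {1,…,n} is represented by Fin n, the element k : Fin n
-- standing for the number suc (toℕ k).  A permutation σ ∈ 𝔖_n is a
-- Permutation′ n; its value at the element k, read in [n], is  val σ k .
val : ∀ {n} → Permutation′ n → Fin n → ℕ
val σ k = suc (toℕ (σ ⟨$⟩ʳ k))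

swapℕ : ℕ → ℕ → ℕ → ℕ
swapℕ a b m = if m ≡ᵇ a then b else (if m ≡ᵇ b then a else m)

countF : ∀ {n} → (Fin n → Bool) → ℕ
countF {zero}  f = 0
countF {suc n} f = (if f F.zero then 1 else 0) + countF (λ k → f (F.suc k))

maxF : ∀ {n} → (Fin n → ℕ) → ℕ
maxF {zero}  f = 0
maxF {suc n} f = f F.zero ⊔ maxF (λ k → f (F.suc k))

-- Ordered set partitions of [n]:  S₁|⋯|S_k  is encoded by the map
-- blk : [n] → ℕ  sending x to (index of its block) − 1; the image must be
-- the initial segment {0,…,k−1} (blocks are nonempty).
record OSP (n : ℕ) : Set where
  field
    blk     : Fin n → ℕ
    initial : ∀ (x : Fin n) (j : ℕ) → j < blk x → Σ (Fin n) (λ y → blk y ≡ j)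
open OSP public

_≈ₒ_ : ∀ {n} → OSP n → OSP n → Set
T ≈ₒ U = ∀ x → blk T x ≡ blk U x

-- number of blocks (for n ≥ 1) and rank  n − #blocks
numBlocks : ∀ {n} → OSP n → ℕ
numBlocks T = suc (maxF (blk T))

rank : ∀ {n} → OSP n → ℕ
rank {n} T = n ∸ numBlocks T

-- Order of 𝒪_n: T ≤ U iff U is obtained from T by merging consecutive
-- blocks, i.e. U's block index is a weakly increasing function of T's.
_≤ₒ_ : ∀ {n} → OSP n → OSP n → Set
T ≤ₒ U = Σ (ℕ → ℕ) (λ g → (∀ a b → a ≤ b → g a ≤ g b) × (∀ x → blk U x ≡ g (blk T x)))

Subset𝒪 : ℕ → Set₁
Subset𝒪 n = OSP n → Set

IsChain : ∀ {n} → Subset𝒪 n → Set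
IsChain C = ∀ T U → C T → C U → (T ≤ₒ U) ⊎ (U ≤ₒ T)

IsMaximalChain : ∀ {n} → Subset𝒪 n → Set
IsMaximalChain C = IsChain C × (∀ V → (∀ T → C T → (T ≤ₒ V) ⊎ (V ≤ₒ T)) → C V)

-- Element x sits at position π(x) of the
-- sequence π⁻¹(1),…,π⁻¹(d+1); bar j (between positions j and j+1) has
-- label τ(j).  After deleting bars with label ≤ r, the (0-based) block of x
-- is the number of remaining bars j with j < π(x).
Tblk : ∀ {d} → Permutation′ (suc d) → Permutation′ d → ℕ → Fin (suc d) → ℕ
Tblk π τ r x = countF (λ j → (suc (toℕ j) <ᵇ val π x) ∧ (r <ᵇ val τ j))

ch : ∀ {d} → Permutation′ (suc d) → Permutation′ d → Subset𝒪 (suc d)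
ch {d} π τ T = Σ ℕ (λ r → (r ≤ d) × (∀ x → blk T x ≡ Tblk π τ r x))

UniqueOutside : ∀ {n} → Subset𝒪 n → Subset𝒪 n → OSP n → Set
UniqueOutside C₁ C₂ T = C₁ T × ¬ C₂ T × (∀ U → C₁ U → ¬ C₂ U → U ≈ₒ T)

DifferInExactlyOne : ∀ {n} → Subset𝒪 n → Subset𝒪 n → Set
DifferInExactlyOne {n} C₁ C₂ =
  Σ (OSP n) (λ T → Σ (OSP n) (λ T' → UniqueOutside C₁ C₂ T × UniqueOutside C₂ C₁ T'))

-- 𝒯(π,τ;s) is the partition cut out of the sequence π by the cut set  cutsAt τ s
-- of bars with label > s; the block of an element is the number of kept bars
-- before its position (cutsBefore).  Prefix counts determine cut sets, and
-- 𝒯(π,τ;s) has rank s, so every element of ch(π,τ) has a well defined level.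
-- We show that ch(π,τ) is a maximal chain (a partition comparable with all levels
-- is squeezed between two consecutive ones), and that two such chains differ in
-- exactly one element iff they agree at all levels but one.  Agreement at all
-- levels t ≠ r relates the labels (resp. at level 0 the positions) pointwise by
-- "equal or exchanged k ↔ k+1" (SwapOrFix), and injectivity upgrades this to a
-- transposition.

module Submission where

open import Defs
open import Data.Nat using (ℕ; zero; suc; _≤_; _<_; _+_; _∸_; _⊔_; _<ᵇ_; _≤ᵇ_; _≡ᵇ_; z≤n; s≤s)
open import Data.Nat.Properties
open import Data.Bool using (Bool; true; false; _∧_; not; if_then_else_; T)
open import Data.Bool.Properties using (∧-zeroʳ; ∧-identityʳ)
open import Data.Unit using (tt)
open import Data.Fin using (Fin; toℕ; fromℕ<)
import Data.Fin as F
import Data.Fin.Properties as FP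
open import Data.Fin.Permutation using (Permutation′; _⟨$⟩ʳ_; _⟨$⟩ˡ_; inverseˡ; inverseʳ)
open import Data.Product using (Σ; _×_; _,_; proj₁; proj₂)
open import Data.Sum using (_⊎_; inj₁; inj₂)
open import Data.Empty using (⊥-elim)
open import Function.Definitions using (Injective)
open import Relation.Nullary using (¬_; yes; no; does)
open import Relation.Nullary.Decidable using (dec-true; dec-false)
open import Relation.Binary.Definitions using (tri<; tri≈; tri>)
open import Relation.Binary.PropositionalEquality
open import Algebra.Properties.CommutativeSemigroup +-commutativeSemigroup using (x∙yz≈y∙xz)
open import Function using (_∘_)

<ᵇ-true : ∀ {m n} → m < n → (m <ᵇ n) ≡ true
<ᵇ-true {m} {n} = dec-true (m <? n)

<ᵇ-false : ∀ {m n} → n ≤ m → (m <ᵇ n) ≡ false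
<ᵇ-false {m} {n} n≤m = dec-false (m <? n) (≤⇒≯ n≤m)

<ᵇ-true⁻¹ : ∀ {m n} → (m <ᵇ n) ≡ true → m < n
<ᵇ-true⁻¹ {m} {n} e = <ᵇ⇒< m n (subst T (sym e) tt)

<ᵇ-false⁻¹ : ∀ {m n} → (m <ᵇ n) ≡ false → n ≤ m
<ᵇ-false⁻¹ e = ≮⇒≥ (λ m<n → subst T e (<⇒<ᵇ m<n))

≤ᵇ-true : ∀ {m n} → m ≤ n → (m ≤ᵇ n) ≡ true
≤ᵇ-true {m} {n} = dec-true (m ≤? n)

≤ᵇ-false : ∀ {m n} → n < m → (m ≤ᵇ n) ≡ false
≤ᵇ-false {m} {n} n<m = dec-false (m ≤? n) (<⇒≱ n<m)

≤ᵇ-true⁻¹ : ∀ {m n} → (m ≤ᵇ n) ≡ true → m ≤ n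
≤ᵇ-true⁻¹ {m} {n} e = ≤ᵇ⇒≤ m n (subst T (sym e) tt)

true≢false : true ≢ false
true≢false ()

ind : Bool → ℕ
ind b = if b then 1 else 0

_⊆ᵇ_ : ∀ {n} → (Fin n → Bool) → (Fin n → Bool) → Set
f ⊆ᵇ g = ∀ k → f k ≡ true → g k ≡ true

⊆ᵇ-antisym : ∀ {n} {f g : Fin n → Bool} → f ⊆ᵇ g → g ⊆ᵇ f → ∀ k → f k ≡ g k
⊆ᵇ-antisym {f = f} {g} f⊆g g⊆f k with f k in fk | g k in gk
... | true  | true  = refl
... | false | false = refl
... | true  | false = trans (sym (f⊆g k fk)) gk
... | false | true  = trans (sym fk) (g⊆f k gk)

squeeze : ∀ {n} (C′ X C : Fin n → Bool) (k : Fin n) → C′ ⊆ᵇ X → X ⊆ᵇ C →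
  (∀ j → j ≢ k → C j ≡ C′ j) → (∀ j → X j ≡ C j) ⊎ (∀ j → X j ≡ C′ j)
squeeze C′ X C k C′⊆X X⊆C agree with X k in Xk
... | true  = inj₁ (⊆ᵇ-antisym X⊆C C⊆X)
  where
  C⊆X : C ⊆ᵇ X
  C⊆X j Cj with j FP.≟ k
  ... | yes refl = Xk
  ... | no j≢k   = C′⊆X j (trans (sym (agree j j≢k)) Cj)
... | false = inj₂ (⊆ᵇ-antisym X⊆C′ C′⊆X)
  where
  X⊆C′ : X ⊆ᵇ C′
  X⊆C′ j Xj with j FP.≟ k
  ... | yes refl = ⊥-elim (true≢false (trans (sym Xj) Xk))
  ... | no j≢k   = trans (sym (agree j j≢k)) (X⊆C j Xj)

countF-cong : ∀ {n} {f g : Fin n → Bool} → (∀ k → f k ≡ g k) → countF f ≡ countF g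
countF-cong {zero}  e = refl
countF-cong {suc n} e = cong₂ (λ b c → ind b + c) (e F.zero) (countF-cong (e ∘ F.suc))

countF-false : ∀ {n} → countF {n} (λ _ → false) ≡ 0
countF-false {zero}  = refl
countF-false {suc n} = countF-false {n}

countF-true : ∀ {n} → countF {n} (λ _ → true) ≡ n
countF-true {zero}  = refl
countF-true {suc n} = cong suc (countF-true {n})

countF-mono : ∀ {n} {f g : Fin n → Bool} → f ⊆ᵇ g → countF f ≤ countF g
countF-mono {zero}          f⊆g = z≤n
countF-mono {suc n} {f} {g} f⊆g = +-mono-≤ (ind-mono (f⊆g F.zero)) (countF-mono (f⊆g ∘ F.suc))
  where
  ind-mono : ∀ {a b} → (a ≡ true → b ≡ true) → ind a ≤ ind b
  ind-mono {false} _ = z≤n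
  ind-mono {true}  h rewrite h refl = ≤-refl

countF-remove : ∀ {n} (f f′ : Fin n → Bool) (k : Fin n) → f k ≡ true → f′ k ≡ false →
  (∀ j → j ≢ k → f j ≡ f′ j) → countF f ≡ suc (countF f′)
countF-remove {suc n} f f′ F.zero fk f′k agree rewrite fk | f′k =
  cong suc (countF-cong (λ j → agree (F.suc j) (λ ())))
countF-remove {suc n} f f′ (F.suc k) fk f′k agree rewrite agree F.zero (λ ()) = begin
  ind (f′ F.zero) + countF (f ∘ F.suc)        ≡⟨ cong (ind (f′ F.zero) +_) (countF-remove (f ∘ F.suc) (f′ ∘ F.suc) k fk f′k
                                                   (λ j j≢k → agree (F.suc j) (j≢k ∘ FP.suc-injective))) ⟩
  ind (f′ F.zero) + suc (countF (f′ ∘ F.suc)) ≡⟨ +-suc (ind (f′ F.zero)) _ ⟩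
  suc (ind (f′ F.zero) + countF (f′ ∘ F.suc)) ∎
  where open ≡-Reasoning

-- A cut set C : Fin d → Bool marks which of the d bars between d+1 consecutive
-- positions are kept.  The element in (0-based) position p then lies in block
-- number cutsBefore C p, the number of kept bars j < p.

cutsBefore : ∀ {d} → (Fin d → Bool) → ℕ → ℕ
cutsBefore C p = countF (λ j → (toℕ j <ᵇ p) ∧ C j)

cutsBefore-cong : ∀ {d} {C C′ : Fin d → Bool} → (∀ j → C j ≡ C′ j) → ∀ p → cutsBefore C p ≡ cutsBefore C′ p
cutsBefore-cong same p = countF-cong (λ j → cong ((toℕ j <ᵇ p) ∧_) (same j))

cutsBefore-zero : ∀ {d} (C : Fin d → Bool) → cutsBefore C 0 ≡ 0
cutsBefore-zero {d} C = countF-false {d}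

cutsBefore-step : ∀ {d} (C : Fin d → Bool) (j : Fin d) →
  cutsBefore C (suc (toℕ j)) ≡ ind (C j) + cutsBefore C (toℕ j)
cutsBefore-step {suc d} C F.zero    = refl
cutsBefore-step {suc d} C (F.suc j) =
  trans (cong (ind (C F.zero) +_) (cutsBefore-step (C ∘ F.suc) j)) (x∙yz≈y∙xz (ind (C F.zero)) (ind (C (F.suc j))) _)

cutsBefore-skip : ∀ {d} (C : Fin d → Bool) (j : Fin d) → C j ≡ false →
  cutsBefore C (suc (toℕ j)) ≡ cutsBefore C (toℕ j)
cutsBefore-skip C j Cj = trans (cutsBefore-step C j) (cong (λ b → ind b + cutsBefore C (toℕ j)) Cj)

cutsBefore-jump : ∀ {d} (C : Fin d → Bool) (j : Fin d) → C j ≡ true →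
  cutsBefore C (suc (toℕ j)) ≡ suc (cutsBefore C (toℕ j))
cutsBefore-jump C j Cj = trans (cutsBefore-step C j) (cong (λ b → ind b + cutsBefore C (toℕ j)) Cj)

cutsBefore-mono : ∀ {d} (C : Fin d → Bool) {p q} → p ≤ q → cutsBefore C p ≤ cutsBefore C q
cutsBefore-mono C {p} {q} p≤q = countF-mono earlier⇒earlier
  where
  earlier⇒earlier : ∀ j → ((toℕ j <ᵇ p) ∧ C j) ≡ true → ((toℕ j <ᵇ q) ∧ C j) ≡ true
  earlier⇒earlier j e with toℕ j <ᵇ p in j<p
  ... | true rewrite <ᵇ-true (<-≤-trans (<ᵇ-true⁻¹ j<p) p≤q) = e

cutsBefore-full : ∀ {d} (C : Fin d → Bool) {p} → d ≤ p → cutsBefore C p ≡ countF C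
cutsBefore-full C d≤p = countF-cong (λ j → cong (_∧ C j) (<ᵇ-true (<-≤-trans (FP.toℕ<n j) d≤p)))

atBar : ∀ {d} (P : ℕ → Fin d → Set) → (∀ j → P (toℕ j) j) → ∀ {p} (p<d : p < d) → P p (fromℕ< p<d)
atBar P h p<d = subst (λ m → P m (fromℕ< p<d)) (FP.toℕ-fromℕ< p<d) (h (fromℕ< p<d))

cutsBefore-stepℕ : ∀ {d} (C : Fin d → Bool) {p} (p<d : p < d) →
  cutsBefore C (suc p) ≡ ind (C (fromℕ< p<d)) + cutsBefore C p
cutsBefore-stepℕ C = atBar (λ m j → cutsBefore C (suc m) ≡ ind (C j) + cutsBefore C m) (cutsBefore-step C)

cutsBefore-unique : ∀ {d} (C : Fin d → Bool) (h : ℕ → ℕ) → h 0 ≡ 0 →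
  (∀ j → h (suc (toℕ j)) ≡ ind (C j) + h (toℕ j)) → ∀ p → p ≤ d → h p ≡ cutsBefore C p
cutsBefore-unique C h h0 hstep zero    _   = trans h0 (sym (cutsBefore-zero C))
cutsBefore-unique {d} C h h0 hstep (suc p) p<d = begin
  h (suc p)                    ≡⟨ atBar (λ m j → h (suc m) ≡ ind (C j) + h m) hstep p<d ⟩
  ind (C b) + h p              ≡⟨ cong (ind (C b) +_) (cutsBefore-unique C h h0 hstep p (<⇒≤ p<d)) ⟩
  ind (C b) + cutsBefore C p   ≡⟨ sym (cutsBefore-stepℕ C p<d) ⟩
  cutsBefore C (suc p)         ∎
  where
  open ≡-Reasoning
  b : Fin d
  b = fromℕ< p<d

cutsBefore-injective : ∀ {d} (C C′ : Fin d → Bool) →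
  (∀ p → p ≤ d → cutsBefore C p ≡ cutsBefore C′ p) → ∀ j → C j ≡ C′ j
cutsBefore-injective C C′ same j = ind-injective (+-cancelʳ-≡ _ (ind (C j)) (ind (C′ j)) (begin
  ind (C j) + cutsBefore C (toℕ j)    ≡⟨ sym (cutsBefore-step C j) ⟩
  cutsBefore C (suc (toℕ j))          ≡⟨ same (suc (toℕ j)) (FP.toℕ<n j) ⟩
  cutsBefore C′ (suc (toℕ j))         ≡⟨ cutsBefore-step C′ j ⟩
  ind (C′ j) + cutsBefore C′ (toℕ j)  ≡⟨ cong (ind (C′ j) +_) (sym (same (toℕ j) (<⇒≤ (FP.toℕ<n j)))) ⟩
  ind (C′ j) + cutsBefore C (toℕ j)   ∎))
  where
  open ≡-Reasoning
  ind-injective : ∀ {a b} → ind a ≡ ind b → a ≡ b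
  ind-injective {true}  {true}  _ = refl
  ind-injective {false} {false} _ = refl

cutsBefore-flat : ∀ {d} (C : Fin d → Bool) {p q} (j : Fin d) → p ≤ toℕ j → toℕ j < q →
  cutsBefore C p ≡ cutsBefore C q → C j ≡ false
cutsBefore-flat C {p} {q} j p≤j j<q flat with C j in Cj
... | false = refl
... | true  = ⊥-elim (<-irrefl flat (begin-strict
  cutsBefore C p              ≤⟨ cutsBefore-mono C p≤j ⟩
  cutsBefore C (toℕ j)        <⟨ n<1+n _ ⟩
  suc (cutsBefore C (toℕ j))  ≡⟨ sym (cutsBefore-jump C j Cj) ⟩
  cutsBefore C (suc (toℕ j))  ≤⟨ cutsBefore-mono C j<q ⟩
  cutsBefore C q              ∎))
  where open ≤-Reasoning

cutsBefore-allCuts : ∀ {d} (C : Fin d → Bool) p → p ≤ d → (∀ j → toℕ j < p → C j ≡ true) →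
  cutsBefore C p ≡ p
cutsBefore-allCuts C zero    _   _    = cutsBefore-zero C
cutsBefore-allCuts {d} C (suc p) p<d cuts = begin
  cutsBefore C (suc p)      ≡⟨ cutsBefore-stepℕ C p<d ⟩
  ind (C b) + cutsBefore C p ≡⟨ cong₂ (λ c n → ind c + n)
                                  (cuts b (≤-reflexive (cong suc (FP.toℕ-fromℕ< p<d))))
                                  (cutsBefore-allCuts C p (<⇒≤ p<d) (λ j j<p → cuts j (m<n⇒m<1+n j<p))) ⟩
  suc p                      ∎
  where
  open ≡-Reasoning
  b : Fin d
  b = fromℕ< p<d

-- Prefix counts grow by steps of at most one, so every smaller value is attained
-- at an earlier position.
cutsBefore-attains : ∀ {d} (C : Fin d → Bool) p → p ≤ d → ∀ m → m < cutsBefore C p →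
  Σ ℕ λ q → q < p × cutsBefore C q ≡ m
cutsBefore-attains C zero    _   m m<0 = ⊥-elim (n≮0 (subst (m <_) (cutsBefore-zero C) m<0))
cutsBefore-attains C (suc p) p<d m m<c with m <? cutsBefore C p
... | yes m<c′ with cutsBefore-attains C p (<⇒≤ p<d) m m<c′
...   | q , q<p , e = q , m<n⇒m<1+n q<p , e
cutsBefore-attains C (suc p) p<d m m<c | no m≮c′ = p , n<1+n p , ≤-antisym (≮⇒≥ m≮c′) (≤-pred (begin
  suc m                                        ≤⟨ m<c ⟩
  cutsBefore C (suc p)                         ≡⟨ cutsBefore-stepℕ C p<d ⟩
  ind (C (fromℕ< p<d)) + cutsBefore C p        ≤⟨ +-monoˡ-≤ _ (ind≤1 (C (fromℕ< p<d))) ⟩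
  suc (cutsBefore C p)                         ∎))
  where
  open ≤-Reasoning
  ind≤1 : ∀ b → ind b ≤ 1
  ind≤1 true  = ≤-refl
  ind≤1 false = z≤n

data SwapOrFix (k a b : ℕ) : Set where
  fixed : a ≡ b → SwapOrFix k a b
  up    : a ≡ k → b ≡ suc k → SwapOrFix k a b
  down  : a ≡ suc k → b ≡ k → SwapOrFix k a b

SwapOrFix-suc : ∀ {k a b} → SwapOrFix k a b → SwapOrFix (suc k) (suc a) (suc b)
SwapOrFix-suc (fixed e)  = fixed (cong suc e)
SwapOrFix-suc (up e f)   = up (cong suc e) (cong suc f)
SwapOrFix-suc (down e f) = down (cong suc e) (cong suc f)

SwapOrFix-pred : ∀ {k a b} → SwapOrFix (suc k) (suc a) (suc b) → SwapOrFix k a b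
SwapOrFix-pred (fixed e)  = fixed (suc-injective e)
SwapOrFix-pred (up e f)   = up (suc-injective e) (suc-injective f)
SwapOrFix-pred (down e f) = down (suc-injective e) (suc-injective f)

≡ᵇ-refl : ∀ m → (m ≡ᵇ m) ≡ true
≡ᵇ-refl m = dec-true (m ≟ m) refl

≡ᵇ-false : ∀ {m n} → m ≢ n → (m ≡ᵇ n) ≡ false
≡ᵇ-false {m} {n} = dec-false (m ≟ n)

swapℕ-k : ∀ k → swapℕ k (suc k) k ≡ suc k
swapℕ-k k rewrite ≡ᵇ-refl k = refl

swapℕ-suck : ∀ k → swapℕ k (suc k) (suc k) ≡ k
swapℕ-suck k rewrite ≡ᵇ-false (1+n≢n {k}) | ≡ᵇ-refl k = refl

swapℕ-fixed : ∀ {k a} → a ≢ k → a ≢ suc k → swapℕ k (suc k) a ≡ a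
swapℕ-fixed a≢k a≢sk rewrite ≡ᵇ-false a≢k | ≡ᵇ-false a≢sk = refl

swapℕ-SwapOrFix : ∀ k a → SwapOrFix k a (swapℕ k (suc k) a)
swapℕ-SwapOrFix k a with a ≟ k
... | yes refl = up refl (swapℕ-k a)
... | no a≢k with a ≟ suc k
...   | yes refl = down refl (swapℕ-suck k)
...   | no a≢sk  = fixed (sym (swapℕ-fixed a≢k a≢sk))

SwapOrFix-threshold : ∀ {k a b} → SwapOrFix k a b → ∀ t → t ≢ k → (t <ᵇ a) ≡ (t <ᵇ b)
SwapOrFix-threshold (fixed refl)    t t≢k = refl
SwapOrFix-threshold (up refl refl)   t t≢k = threshold-step t≢k
  where
  threshold-step : ∀ {t k} → t ≢ k → (t <ᵇ k) ≡ (t <ᵇ suc k)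
  threshold-step {t} {k} t≢k with <-cmp t k
  ... | tri< t<k _ _ = trans (<ᵇ-true t<k) (sym (<ᵇ-true (m<n⇒m<1+n t<k)))
  ... | tri≈ _ t≡k _ = ⊥-elim (t≢k t≡k)
  ... | tri> _ _ k<t = trans (<ᵇ-false (<⇒≤ k<t)) (sym (<ᵇ-false k<t))
SwapOrFix-threshold (down refl refl) t t≢k = sym (SwapOrFix-threshold (up refl refl) t t≢k)

-- Conversely, thresholds t ≠ k that see a < b identically force a = k and
-- b = k+1 (look at the thresholds a and b−1).
threshold-crossing : ∀ {k a b} → (∀ t → t ≢ k → (t <ᵇ a) ≡ (t <ᵇ b)) → a < b → a ≡ k × b ≡ suc k
threshold-crossing {k} {a} {suc b′} same (s≤s a≤b′) = a≡k , cong suc b′≡k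
  where
  a≡k : a ≡ k
  a≡k with a ≟ k
  ... | yes e = e
  ... | no a≢k = ⊥-elim (<-irrefl refl (<ᵇ-true⁻¹ {a} {a} (trans (same a a≢k) (<ᵇ-true (s≤s a≤b′)))))
  b′≡k : b′ ≡ k
  b′≡k with b′ ≟ k
  ... | yes e = e
  ... | no b′≢k = ⊥-elim (<⇒≱ (<ᵇ-true⁻¹ (trans (same b′ b′≢k) (<ᵇ-true (n<1+n b′)))) a≤b′)

threshold-SwapOrFix : ∀ k a b → (∀ t → t ≢ k → (t <ᵇ a) ≡ (t <ᵇ b)) → SwapOrFix k a b
threshold-SwapOrFix k a b same with <-cmp a b
... | tri< a<b _ _ = up (proj₁ crossing) (proj₂ crossing)
  where
  crossing : a ≡ k × b ≡ suc k
  crossing = threshold-crossing same a<b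
... | tri≈ _ a≡b _ = fixed a≡b
... | tri> _ _ b<a = down (proj₂ crossing) (proj₁ crossing)
  where
  crossing : b ≡ k × a ≡ suc k
  crossing = threshold-crossing (λ t t≢k → sym (same t t≢k)) b<a

-- Injective labellings f, g that are everywhere related by SwapOrFix k but are
-- not equal differ exactly by the transposition (k,k+1): a moved point takes
-- both values k and k+1, so by injectivity no fixed point takes either.
SwapOrFix-transposition : ∀ {n k} (f g : Fin n → ℕ) → Injective _≡_ _≡_ f → Injective _≡_ _≡_ g →
  (∀ x → SwapOrFix k (f x) (g x)) → ¬ (∀ x → f x ≡ g x) → ∀ x → g x ≡ swapℕ k (suc k) (f x)
SwapOrFix-transposition {n} {k} f g f-inj g-inj rel differ x with rel x
... | up fx≡k gx≡sk = trans gx≡sk (sym (trans (cong (swapℕ k (suc k)) fx≡k) (swapℕ-k k)))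
... | down fx≡sk gx≡k = trans gx≡k (sym (trans (cong (swapℕ k (suc k)) fx≡sk) (swapℕ-suck k)))
... | fixed fx≡gx = sym (trans (swapℕ-fixed (avoids k (proj₁ hits)) (avoids (suc k) (proj₂ hits))) fx≡gx)
  where
  moved : Σ (Fin n) λ x₀ → f x₀ ≢ g x₀
  moved = FP.¬∀⟶∃¬ n _ (λ y → f y ≟ g y) differ
  x₀ : Fin n
  x₀ = proj₁ moved
  hits : ((f x₀ ≡ k) ⊎ (g x₀ ≡ k)) × ((f x₀ ≡ suc k) ⊎ (g x₀ ≡ suc k))
  hits with rel x₀
  ... | fixed e  = ⊥-elim (proj₂ moved e)
  ... | up e e′   = inj₁ e , inj₂ e′
  ... | down e e′ = inj₂ e′ , inj₁ e
  not-moved : x₀ ≢ x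
  not-moved refl = proj₂ moved fx≡gx
  avoids : ∀ v → (f x₀ ≡ v) ⊎ (g x₀ ≡ v) → f x ≢ v
  avoids v (inj₁ fx₀≡v) fx≡v = not-moved (f-inj (trans fx₀≡v (sym fx≡v)))
  avoids v (inj₂ gx₀≡v) fx≡v = not-moved (g-inj (trans gx₀≡v (sym (trans (sym fx≡gx) fx≡v))))

cutsBefore-SwapOrFix : ∀ {d} (C : Fin d → Bool) (i : Fin d) → C i ≡ false →
  ∀ {p q} → SwapOrFix (toℕ i) p q → cutsBefore C p ≡ cutsBefore C q
cutsBefore-SwapOrFix C i Ci (fixed p≡q)      = cong (cutsBefore C) p≡q
cutsBefore-SwapOrFix C i Ci (up refl refl)   = sym (cutsBefore-skip C i Ci)
cutsBefore-SwapOrFix C i Ci (down refl refl) = cutsBefore-skip C i Ci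

cutsBefore-flatStretch : ∀ {d} (C : Fin d → Bool) (i : Fin d) → (∀ j → C j ≡ false → j ≡ i) →
  ∀ {p q} → p < q → q ≤ d → cutsBefore C p ≡ cutsBefore C q → p ≡ toℕ i × q ≡ suc (toℕ i)
cutsBefore-flatStretch {d} C i onlyGap {p} {q} p<q q≤d flat = p≡i , q≡si
  where
  gapAt : ∀ {m} (m<d : m < d) → p ≤ m → m < q → m ≡ toℕ i
  gapAt m<d p≤m m<q = trans (sym (FP.toℕ-fromℕ< m<d)) (cong toℕ (onlyGap _
    (cutsBefore-flat C _ (subst (p ≤_) (sym (FP.toℕ-fromℕ< m<d)) p≤m)
                         (subst (_< q) (sym (FP.toℕ-fromℕ< m<d)) m<q) flat)))
  p≡i : p ≡ toℕ i
  p≡i = gapAt (<-≤-trans p<q q≤d) ≤-refl p<q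
  q≡si : q ≡ suc (toℕ i)
  q≡si with suc p <? q
  ... | no sp≮q  = trans (≤-antisym (≮⇒≥ sp≮q) p<q) (cong suc p≡i)
  ... | yes sp<q = ⊥-elim (1+n≢n (trans (gapAt (<-≤-trans sp<q q≤d) (n≤1+n p) sp<q) (sym p≡i)))

cutsBefore-oneGap : ∀ {d} (C : Fin d → Bool) (i : Fin d) → (∀ j → C j ≡ false → j ≡ i) →
  ∀ {p q} → p ≤ d → q ≤ d → cutsBefore C p ≡ cutsBefore C q → SwapOrFix (toℕ i) p q
cutsBefore-oneGap C i onlyGap {p} {q} p≤d q≤d same with <-cmp p q
... | tri< p<q _ _ = up (proj₁ stretch) (proj₂ stretch)
  where
  stretch : p ≡ toℕ i × q ≡ suc (toℕ i)
  stretch = cutsBefore-flatStretch C i onlyGap p<q q≤d same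
... | tri≈ _ p≡q _ = fixed p≡q
... | tri> _ _ q<p = down (proj₂ stretch) (proj₁ stretch)
  where
  stretch : q ≡ toℕ i × p ≡ suc (toℕ i)
  stretch = cutsBefore-flatStretch C i onlyGap q<p p≤d (sym same)

-- 0-based position of x in the sequence π⁻¹(1),…,π⁻¹(d+1).
pos : ∀ {d} → Permutation′ (suc d) → Fin (suc d) → ℕ
pos π x = toℕ (π ⟨$⟩ʳ x)

pos≤ : ∀ {d} (π : Permutation′ (suc d)) x → pos π x ≤ d
pos≤ π x = FP.toℕ≤pred[n] (π ⟨$⟩ʳ x)

clamp : (d : ℕ) → ℕ → Fin (suc d)
clamp d       zero    = F.zero
clamp zero    (suc p) = F.zero
clamp (suc d) (suc p) = F.suc (clamp d p)

toℕ-clamp : ∀ {d p} → p ≤ d → toℕ (clamp d p) ≡ p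
toℕ-clamp {d}     {zero}  _         = refl
toℕ-clamp {suc d} {suc p} (s≤s p≤d) = cong suc (toℕ-clamp p≤d)

clamp-toℕ : ∀ {d} (x : Fin (suc d)) → clamp d (toℕ x) ≡ x
clamp-toℕ {d}     F.zero    = refl
clamp-toℕ {suc d} (F.suc x) = cong F.suc (clamp-toℕ x)

-- The element in position p (meaningful for p ≤ d).
elemAt : ∀ {d} → Permutation′ (suc d) → ℕ → Fin (suc d)
elemAt {d} π p = π ⟨$⟩ˡ clamp d p

pos-elemAt : ∀ {d} (π : Permutation′ (suc d)) {p} → p ≤ d → pos π (elemAt π p) ≡ p
pos-elemAt π p≤d = trans (cong toℕ (inverseʳ π)) (toℕ-clamp p≤d)

elemAt-pos : ∀ {d} (π : Permutation′ (suc d)) x → elemAt π (pos π x) ≡ x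
elemAt-pos π x = trans (cong (π ⟨$⟩ˡ_) (clamp-toℕ _)) (inverseˡ π)

val-injective : ∀ {n} (σ : Permutation′ n) → Injective _≡_ _≡_ (val σ)
val-injective σ {a} {b} e = begin
  a                        ≡⟨ sym (inverseˡ σ) ⟩
  σ ⟨$⟩ˡ (σ ⟨$⟩ʳ a)        ≡⟨ cong (σ ⟨$⟩ˡ_) (FP.toℕ-injective (suc-injective e)) ⟩
  σ ⟨$⟩ˡ (σ ⟨$⟩ʳ b)        ≡⟨ inverseˡ σ ⟩
  b                        ∎
  where open ≡-Reasoning

val≤ : ∀ {d} (τ : Permutation′ d) j → val τ j ≤ d
val≤ τ j = FP.toℕ<n (τ ⟨$⟩ʳ j)

-- The bar with label s+1, i.e. τ⁻¹(s+1).
labelAt : ∀ {d} (τ : Permutation′ d) s → s < d → Fin d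
labelAt τ s s<d = τ ⟨$⟩ˡ fromℕ< s<d

val-labelAt : ∀ {d} (τ : Permutation′ d) s (s<d : s < d) → val τ (labelAt τ s s<d) ≡ suc s
val-labelAt τ s s<d = cong suc (trans (cong toℕ (inverseʳ τ)) (FP.toℕ-fromℕ< s<d))

-- The cut set at level s: the bars left after deleting those with label ≤ s,
-- so that  Tblk π τ s x  is  cutsBefore (cutsAt τ s) (pos π x)  by definition.

cutsAt : ∀ {d} → Permutation′ d → ℕ → Fin d → Bool
cutsAt τ s j = s <ᵇ val τ j

cutsAt-antitone : ∀ {d} (τ : Permutation′ d) {s t} → s ≤ t → cutsAt τ t ⊆ᵇ cutsAt τ s
cutsAt-antitone τ {s} {t} s≤t j t<v = <ᵇ-true (≤-<-trans s≤t (<ᵇ-true⁻¹ {t} {val τ j} t<v))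

cutsAt-top : ∀ {d} (τ : Permutation′ d) j → cutsAt τ d j ≡ false
cutsAt-top τ j = <ᵇ-false (val≤ τ j)

cutsAt-step : ∀ {d} (τ : Permutation′ d) s (s<d : s < d) →
  cutsAt τ s (labelAt τ s s<d) ≡ true × cutsAt τ (suc s) (labelAt τ s s<d) ≡ false
  × (∀ j → j ≢ labelAt τ s s<d → cutsAt τ s j ≡ cutsAt τ (suc s) j)
cutsAt-step τ s s<d =
  subst (λ v → (s <ᵇ v) ≡ true) (sym (val-labelAt τ s s<d)) (<ᵇ-true (n<1+n s)) ,
  subst (λ v → (suc s <ᵇ v) ≡ false) (sym (val-labelAt τ s s<d)) (<ᵇ-false {suc s} ≤-refl) ,
  λ j j≢k → threshold-other (λ v≡ss → j≢k (val-injective τ (trans v≡ss (sym (val-labelAt τ s s<d)))))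
  where
  threshold-other : ∀ {v} → v ≢ suc s → (s <ᵇ v) ≡ (suc s <ᵇ v)
  threshold-other {v} v≢ss with <-cmp s v
  ... | tri< s<v _ _ = trans (<ᵇ-true s<v) (sym (<ᵇ-true (≤∧≢⇒< s<v (v≢ss ∘ sym))))
  ... | tri≈ _ s≡v _ = trans (<ᵇ-false (≤-reflexive (sym s≡v))) (sym (<ᵇ-false (≤-trans (≤-reflexive (sym s≡v)) (n≤1+n s))))
  ... | tri> _ _ v<s = trans (<ᵇ-false (<⇒≤ v<s)) (sym (<ᵇ-false (m<n⇒m≤1+n v<s)))

countF-cutsAt : ∀ {d} (τ : Permutation′ d) s → s ≤ d → countF (cutsAt τ s) ≡ d ∸ s
countF-cutsAt {d} τ zero    _   = countF-true {d}
countF-cutsAt {d} τ (suc s) s<d with cutsAt-step τ s s<d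
... | k-in , k-out , others = suc-injective (begin
  suc (countF (cutsAt τ (suc s)))  ≡⟨ sym (countF-remove _ _ _ k-in k-out others) ⟩
  countF (cutsAt τ s)              ≡⟨ countF-cutsAt τ s (<⇒≤ s<d) ⟩
  d ∸ s                            ≡⟨ +-∸-assoc 1 s<d ⟩
  suc (d ∸ suc s)                  ∎)
  where open ≡-Reasoning

-- The ordered set partition cut out of the sequence π by a cut set; its block
-- indices form an initial segment because prefix counts grow by steps of at most one.

mkOSP : ∀ {d} → Permutation′ (suc d) → (Fin d → Bool) → OSP (suc d)
mkOSP π C = record
  { blk     = λ x → cutsBefore C (pos π x)
  ; initial = λ x m m<b → let (q , q<p , e) = cutsBefore-attains C (pos π x) (pos≤ π x) m m<b in
      elemAt π q , trans (cong (cutsBefore C) (pos-elemAt π (≤-trans (<⇒≤ q<p) (pos≤ π x)))) e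
  }

𝒯 : ∀ {d} → Permutation′ (suc d) → Permutation′ d → ℕ → OSP (suc d)
𝒯 π τ s = mkOSP π (cutsAt τ s)

𝒯∈ch : ∀ {d} (π : Permutation′ (suc d)) (τ : Permutation′ d) s → s ≤ d → ch π τ (𝒯 π τ s)
𝒯∈ch π τ s s≤d = s , s≤d , λ _ → refl

-- At level 0 no bar is deleted, so the block of x is its position.
Tblk-zero : ∀ {d} (π : Permutation′ (suc d)) (τ : Permutation′ d) x → Tblk π τ 0 x ≡ pos π x
Tblk-zero π τ x = cutsBefore-allCuts (cutsAt τ 0) (pos π x) (pos≤ π x) (λ _ _ → refl)

-- Deleting cuts merges consecutive blocks: if D ⊆ C then mkOSP π C ≤ mkOSP π D.
-- The merging map sends a C-block m to the number of D-cuts lying to the left of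
-- the first C-block after m.
coarsen : ∀ {d} (π : Permutation′ (suc d)) {C D : Fin d → Bool} → D ⊆ᵇ C → mkOSP π C ≤ₒ mkOSP π D
coarsen π {C} {D} D⊆C = merge , merge-mono , λ x → merge-correct (pos π x)
  where
  merge : ℕ → ℕ
  merge m = countF (λ j → D j ∧ (cutsBefore C (suc (toℕ j)) ≤ᵇ m))
  merge-mono : ∀ a b → a ≤ b → merge a ≤ merge b
  merge-mono a b a≤b = countF-mono included
    where
    included : ∀ j → (D j ∧ (cutsBefore C (suc (toℕ j)) ≤ᵇ a)) ≡ true →
               (D j ∧ (cutsBefore C (suc (toℕ j)) ≤ᵇ b)) ≡ true
    included j e with D j
    ... | true = ≤ᵇ-true (≤-trans (≤ᵇ-true⁻¹ {cutsBefore C (suc (toℕ j))} e) a≤b)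
  -- a D-cut j lies before position p iff the C-block right of it is not beyond p's
  merge-correct : ∀ p → cutsBefore D p ≡ merge (cutsBefore C p)
  merge-correct p = countF-cong before⇔
    where
    before⇔ : ∀ j → ((toℕ j <ᵇ p) ∧ D j) ≡ (D j ∧ (cutsBefore C (suc (toℕ j)) ≤ᵇ cutsBefore C p))
    before⇔ j with D j in Dj
    ... | false = ∧-zeroʳ (toℕ j <ᵇ p)
    ... | true with toℕ j <? p
    ...   | yes j<p = trans (∧-identityʳ _) (trans (<ᵇ-true j<p) (sym (≤ᵇ-true (cutsBefore-mono C j<p))))
    ...   | no j≮p  = trans (∧-identityʳ _) (trans (<ᵇ-false (≮⇒≥ j≮p)) (sym (≤ᵇ-false (begin-strict
      cutsBefore C p               ≤⟨ cutsBefore-mono C (≮⇒≥ j≮p) ⟩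
      cutsBefore C (toℕ j)         <⟨ n<1+n _ ⟩
      suc (cutsBefore C (toℕ j))   ≡⟨ sym (cutsBefore-jump C j (D⊆C j Dj)) ⟩
      cutsBefore C (suc (toℕ j))   ∎))))
      where open ≤-Reasoning

≤ₒ-resp-≈ₒ : ∀ {n} (A A′ B B′ : OSP n) → A ≈ₒ A′ → B ≈ₒ B′ → A′ ≤ₒ B′ → A ≤ₒ B
≤ₒ-resp-≈ₒ _ _ _ _ A≈ B≈ (g , g-mono , e) = g , g-mono , λ x → trans (B≈ x) (trans (e x) (cong g (sym (A≈ x))))

-- ch(π,τ) is a chain, since cut sets shrink as the level grows.
isChain : ∀ {d} (π : Permutation′ (suc d)) (τ : Permutation′ d) → IsChain (ch π τ)
isChain π τ T U (s , _ , T≡) (t , _ , U≡) with ≤-total s t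
... | inj₁ s≤t = inj₁ (≤ₒ-resp-≈ₒ T (𝒯 π τ s) U (𝒯 π τ t) T≡ U≡ (coarsen π (cutsAt-antitone τ s≤t)))
... | inj₂ t≤s = inj₂ (≤ₒ-resp-≈ₒ U (𝒯 π τ t) T (𝒯 π τ s) U≡ T≡ (coarsen π (cutsAt-antitone τ t≤s)))

-- Let V be comparable with every 𝒯(π,τ;s).
-- Comparability with the finest element 𝒯(π,τ;0), whose blocks are the
-- positions, makes the block index of V
-- weakly increasing along π; then V is cut out of π by its own cut set cutsOf.
-- Each comparison with a 𝒯(π,τ;s) bounds cutsOf from above or below.  Climbing
-- the levels, cutsOf ends up squeezed between cutsAt τ (s+1) and cutsAt τ s,
-- which differ in a single bar, so it equals one of them.

module Maximality {d} (π : Permutation′ (suc d)) (V : OSP (suc d)) where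

  blockAt : ℕ → ℕ
  blockAt p = blk V (elemAt π p)

  blk≡blockAt : ∀ x → blk V x ≡ blockAt (pos π x)
  blk≡blockAt x = cong (blk V) (sym (elemAt-pos π x))

  cutsOf : Fin d → Bool
  cutsOf j = blockAt (toℕ j) <ᵇ blockAt (suc (toℕ j))

  Monotone : Set
  Monotone = ∀ p q → p ≤ q → q ≤ d → blockAt p ≤ blockAt q

  attained : ∀ p → p ≤ d → ∀ m → m < blockAt p → Σ ℕ λ q → q ≤ d × blockAt q ≡ m
  attained p _ m m<b with initial V (elemAt π p) m m<b
  ... | y , e = pos π y , pos≤ π y , trans (sym (blk≡blockAt y)) e

  -- If mkOSP π C ≤ V, the blocks of V are unions of C-blocks: each cut of V is one of C.
  cuts-of-finer : ∀ {C} → mkOSP π C ≤ₒ V → cutsOf ⊆ᵇ C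
  cuts-of-finer {C} (g , _ , V≡g) j cut with C j in Cj
  ... | true  = refl
  ... | false = ⊥-elim (true≢false (trans (sym cut) (trans (cong (_<ᵇ blockAt (suc (toℕ j))) same) (<ᵇ-false {blockAt (suc (toℕ j))} ≤-refl))))
    where
    blockAt≡g : ∀ p → p ≤ d → blockAt p ≡ g (cutsBefore C p)
    blockAt≡g p p≤d = trans (V≡g (elemAt π p)) (cong (g ∘ cutsBefore C) (pos-elemAt π p≤d))
    same : blockAt (toℕ j) ≡ blockAt (suc (toℕ j))
    same = begin
      blockAt (toℕ j)                    ≡⟨ blockAt≡g (toℕ j) (<⇒≤ (FP.toℕ<n j)) ⟩
      g (cutsBefore C (toℕ j))           ≡⟨ cong g (sym (cutsBefore-skip C j Cj)) ⟩
      g (cutsBefore C (suc (toℕ j)))     ≡⟨ sym (blockAt≡g (suc (toℕ j)) (FP.toℕ<n j)) ⟩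
      blockAt (suc (toℕ j))              ∎
      where open ≡-Reasoning

  module _ (mono : Monotone) where
    blockAt-zero : blockAt 0 ≡ 0
    blockAt-zero with blockAt 0 ≟ 0
    ... | yes b≡0 = b≡0
    ... | no b≢0 with attained 0 z≤n 0 (n≢0⇒n>0 b≢0)
    ...   | q , q≤d , bq≡0 = ⊥-elim (b≢0 (n≤0⇒n≡0 (subst (blockAt 0 ≤_) bq≡0 (mono 0 q z≤n q≤d))))

    blockAt-noSkip : ∀ p → suc p ≤ d → blockAt p < blockAt (suc p) → blockAt (suc p) ≡ suc (blockAt p)
    blockAt-noSkip p sp≤d b<b′ with suc (blockAt p) <? blockAt (suc p)
    ... | no ¬skip = ≤-antisym (≮⇒≥ ¬skip) b<b′
    ... | yes skip with attained (suc p) sp≤d _ skip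
    ...   | q , q≤d , bq with q ≤? p
    ...     | yes q≤p = ⊥-elim (1+n≰n (subst (_≤ blockAt p) bq (mono q p q≤p (≤-trans (n≤1+n p) sp≤d))))
    ...     | no q≰p  = ⊥-elim (<⇒≱ skip (subst (blockAt (suc p) ≤_) bq (mono (suc p) q (≰⇒> q≰p) q≤d)))

    blockAt-step : ∀ j → blockAt (suc (toℕ j)) ≡ ind (cutsOf j) + blockAt (toℕ j)
    blockAt-step j with blockAt (toℕ j) <? blockAt (suc (toℕ j))
    ... | yes b<b′ = trans (blockAt-noSkip (toℕ j) (FP.toℕ<n j) b<b′)
                           (cong (λ c → ind c + blockAt (toℕ j)) (sym (<ᵇ-true b<b′)))
    ... | no b≮b′  = trans (≤-antisym (≮⇒≥ b≮b′) (mono _ _ (n≤1+n _) (FP.toℕ<n j)))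
                           (cong (λ c → ind c + blockAt (toℕ j)) (sym (<ᵇ-false (≮⇒≥ b≮b′))))

    canonical : ∀ x → blk V x ≡ cutsBefore cutsOf (pos π x)
    canonical x = trans (blk≡blockAt x)
      (cutsBefore-unique cutsOf blockAt blockAt-zero blockAt-step (pos π x) (pos≤ π x))

    member : ∀ τ s → s ≤ d → (∀ j → cutsOf j ≡ cutsAt τ s j) → ch π τ V
    member τ s s≤d same = s , s≤d , λ x → trans (canonical x) (cutsBefore-cong same (pos π x))

    -- If V ≤ mkOSP π C, the C-blocks are unions of blocks of V: each cut of C is one of V.
    cuts-of-coarser : ∀ {C} → V ≤ₒ mkOSP π C → C ⊆ᵇ cutsOf
    cuts-of-coarser {C} (g , _ , C≡g) j Cj with blockAt (toℕ j) ≟ blockAt (suc (toℕ j))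
    ... | no b≢b′  = <ᵇ-true (≤∧≢⇒< (mono _ _ (n≤1+n _) (FP.toℕ<n j)) b≢b′)
    ... | yes b≡b′ = ⊥-elim (1+n≢n (begin
      suc (cutsBefore C (toℕ j))         ≡⟨ sym (cutsBefore-jump C j Cj) ⟩
      cutsBefore C (suc (toℕ j))         ≡⟨ cutsBefore≡g (suc (toℕ j)) (FP.toℕ<n j) ⟩
      g (blockAt (suc (toℕ j)))          ≡⟨ cong g (sym b≡b′) ⟩
      g (blockAt (toℕ j))                ≡⟨ sym (cutsBefore≡g (toℕ j) (<⇒≤ (FP.toℕ<n j))) ⟩
      cutsBefore C (toℕ j)               ∎))
      where
      open ≡-Reasoning
      cutsBefore≡g : ∀ p → p ≤ d → cutsBefore C p ≡ g (blockAt p)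
      cutsBefore≡g p p≤d = trans (cong (cutsBefore C) (sym (pos-elemAt π p≤d))) (C≡g (elemAt π p))

  monotone-above-finest : ∀ τ → 𝒯 π τ 0 ≤ₒ V → Monotone
  monotone-above-finest τ (g , g-mono , V≡g) p q p≤q q≤d =
    subst₂ _≤_ (sym (blockAt≡g p (≤-trans p≤q q≤d))) (sym (blockAt≡g q q≤d)) (g-mono p q p≤q)
    where
    blockAt≡g : ∀ p → p ≤ d → blockAt p ≡ g p
    blockAt≡g p p≤d = trans (V≡g (elemAt π p)) (cong g (trans (Tblk-zero π τ (elemAt π p)) (pos-elemAt π p≤d)))

  monotone-below-finest : ∀ τ → V ≤ₒ 𝒯 π τ 0 → Monotone
  monotone-below-finest τ (g , g-mono , pos≡g) p q p≤q q≤d with blockAt p ≤? blockAt q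
  ... | yes b≤b′ = b≤b′
  ... | no b≰b′  = ⊥-elim (b≰b′ (≤-reflexive (cong blockAt (≤-antisym p≤q q≤p))))
    where
    p≡g : ∀ p → p ≤ d → p ≡ g (blockAt p)
    p≡g p p≤d = trans (sym (trans (Tblk-zero π τ (elemAt π p)) (pos-elemAt π p≤d))) (pos≡g (elemAt π p))
    q≤p : q ≤ p
    q≤p = subst₂ _≤_ (sym (p≡g q q≤d)) (sym (p≡g p (≤-trans p≤q q≤d))) (g-mono _ _ (<⇒≤ (≰⇒> b≰b′)))

  module _ (τ : Permutation′ d) (comparable : ∀ T → ch π τ T → (T ≤ₒ V) ⊎ (V ≤ₒ T)) where
    mono : Monotone
    mono with comparable (𝒯 π τ 0) (𝒯∈ch π τ 0 z≤n)
    ... | inj₁ above = monotone-above-finest τ above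
    ... | inj₂ below = monotone-below-finest τ below

    -- Knowing 𝒯(π,τ;s) ≤ V, locate V among the levels s,…,d (n = d − s of them above s).
    climb : ∀ n s → n + s ≡ d → 𝒯 π τ s ≤ₒ V → ch π τ V
    climb zero s refl above = member mono τ s ≤-refl
      (⊆ᵇ-antisym (cuts-of-finer above) (λ j top → ⊥-elim (true≢false (trans (sym top) (cutsAt-top τ j)))))
    climb (suc n) s n+s≡d above = next (comparable (𝒯 π τ (suc s)) (𝒯∈ch π τ (suc s) s<d))
      where
      s<d : suc s ≤ d
      s<d = subst (suc s ≤_) n+s≡d (s≤s (m≤n+m s n))
      next : (𝒯 π τ (suc s) ≤ₒ V) ⊎ (V ≤ₒ 𝒯 π τ (suc s)) → ch π τ V
      next (inj₁ above′) = climb n (suc s) (trans (+-suc n s) n+s≡d) above′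
      next (inj₂ below′) with squeeze _ cutsOf _ _ (cuts-of-coarser mono below′) (cuts-of-finer above)
                                (proj₂ (proj₂ (cutsAt-step τ s s<d)))
      ... | inj₁ at-s   = member mono τ s (<⇒≤ s<d) at-s
      ... | inj₂ at-s+1 = member mono τ (suc s) s<d at-s+1

    inChain : ch π τ V
    inChain with comparable (𝒯 π τ 0) (𝒯∈ch π τ 0 z≤n)
    ... | inj₁ above = climb d 0 (+-identityʳ d) above
    ... | inj₂ below = member mono τ 0 z≤n (⊆ᵇ-antisym (λ _ _ → refl) (cuts-of-coarser mono below))

maximal : ∀ {d} (π : Permutation′ (suc d)) (τ : Permutation′ d) → IsMaximalChain (ch π τ)
maximal π τ = isChain π τ , λ V comparable → Maximality.inChain π V τ comparable

maxF-cong : ∀ {n} {f g : Fin n → ℕ} → (∀ x → f x ≡ g x) → maxF f ≡ maxF g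
maxF-cong {zero}  e = refl
maxF-cong {suc n} e = cong₂ _⊔_ (e F.zero) (maxF-cong (e ∘ F.suc))

maxF-least : ∀ {n} {f : Fin n → ℕ} {M} → (∀ x → f x ≤ M) → maxF f ≤ M
maxF-least {zero}  _ = z≤n
maxF-least {suc n} h = ⊔-lub (h F.zero) (maxF-least (h ∘ F.suc))

maxF-upper : ∀ {n} (f : Fin n → ℕ) x → f x ≤ maxF f
maxF-upper {suc n} f F.zero    = m≤m⊔n _ _
maxF-upper {suc n} f (F.suc x) = ≤-trans (maxF-upper (f ∘ F.suc) x) (m≤n⊔m _ _)

rank-cong : ∀ {n} (A B : OSP n) → A ≈ₒ B → rank A ≡ rank B
rank-cong {n} A B A≈B = cong (λ m → n ∸ suc m) (maxF-cong A≈B)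

-- The largest block index of 𝒯(π,τ;s) is its number of cuts d − s (reached by
-- the last element), so its rank is s.
rank-at-level : ∀ {d} (π : Permutation′ (suc d)) (τ : Permutation′ d) s (A : OSP (suc d)) →
  (∀ x → blk A x ≡ Tblk π τ s x) → s ≤ d → rank A ≡ s
rank-at-level {d} π τ s A A≡ s≤d = begin
  suc d ∸ suc (maxF (blk A))   ≡⟨ cong (λ m → d ∸ m) (trans (maxF-cong A≡) maxF-level) ⟩
  d ∸ (d ∸ s)                  ≡⟨ m∸[m∸n]≡n s≤d ⟩
  s                            ∎
  where
  open ≡-Reasoning
  C : Fin d → Bool
  C = cutsAt τ s
  last-count : cutsBefore C (pos π (elemAt π d)) ≡ countF C
  last-count = trans (cong (cutsBefore C) (pos-elemAt π ≤-refl)) (cutsBefore-full C ≤-refl)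
  maxF-level : maxF (Tblk π τ s) ≡ d ∸ s
  maxF-level = trans (≤-antisym
    (maxF-least (λ x → ≤-trans (cutsBefore-mono C (pos≤ π x)) (≤-reflexive (cutsBefore-full C ≤-refl))))
    (subst (_≤ maxF (Tblk π τ s)) last-count (maxF-upper (Tblk π τ s) (elemAt π d))))
    (countF-cutsAt τ s s≤d)

SameAt : ∀ {d} → Permutation′ (suc d) → Permutation′ d → Permutation′ (suc d) → Permutation′ d → ℕ → Set
SameAt π₁ τ₁ π₂ τ₂ s = ∀ x → Tblk π₁ τ₁ s x ≡ Tblk π₂ τ₂ s x

-- Since levels are ranks, 𝒯(π₁,τ₁;s) lies in ch(π₂,τ₂) only if the chains agree at level s.
level-in-other : ∀ {d} (π₁ π₂ : Permutation′ (suc d)) (τ₁ τ₂ : Permutation′ d) s → s ≤ d →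
  ch π₂ τ₂ (𝒯 π₁ τ₁ s) → SameAt π₁ τ₁ π₂ τ₂ s
level-in-other π₁ π₂ τ₁ τ₂ s s≤d (t , t≤d , T≡) x = subst (λ u → Tblk π₁ τ₁ s x ≡ Tblk π₂ τ₂ u x) t≡s (T≡ x)
  where
  t≡s : t ≡ s
  t≡s = trans (sym (rank-at-level π₂ τ₂ t (𝒯 π₁ τ₁ s) T≡ t≤d)) (rank-at-level π₁ τ₁ s (𝒯 π₁ τ₁ s) (λ _ → refl) s≤d)

uniqueOutside-at : ∀ {d} (π₁ π₂ : Permutation′ (suc d)) (τ₁ τ₂ : Permutation′ d) ρ → ρ ≤ d →
  (∀ s → s ≤ d → s ≢ ρ → SameAt π₁ τ₁ π₂ τ₂ s) → ¬ SameAt π₁ τ₁ π₂ τ₂ ρ →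
  UniqueOutside (ch π₁ τ₁) (ch π₂ τ₂) (𝒯 π₁ τ₁ ρ)
uniqueOutside-at π₁ π₂ τ₁ τ₂ ρ ρ≤d agree differ =
  𝒯∈ch π₁ τ₁ ρ ρ≤d , differ ∘ level-in-other π₁ π₂ τ₁ τ₂ ρ ρ≤d , unique
  where
  unique : ∀ U → ch π₁ τ₁ U → ¬ ch π₂ τ₂ U → U ≈ₒ 𝒯 π₁ τ₁ ρ
  unique U (s , s≤d , U≡) U∉ with s ≟ ρ
  ... | yes refl = U≡
  ... | no s≢ρ   = ⊥-elim (U∉ (s , s≤d , λ x → trans (U≡ x) (agree s s≤d s≢ρ x)))

differInOne-at : ∀ {d} (π₁ π₂ : Permutation′ (suc d)) (τ₁ τ₂ : Permutation′ d) ρ → ρ ≤ d →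
  (∀ s → s ≤ d → s ≢ ρ → SameAt π₁ τ₁ π₂ τ₂ s) → ¬ SameAt π₁ τ₁ π₂ τ₂ ρ →
  DifferInExactlyOne (ch π₁ τ₁) (ch π₂ τ₂)
differInOne-at π₁ π₂ τ₁ τ₂ ρ ρ≤d agree differ =
  𝒯 π₁ τ₁ ρ , 𝒯 π₂ τ₂ ρ ,
  uniqueOutside-at π₁ π₂ τ₁ τ₂ ρ ρ≤d agree differ ,
  uniqueOutside-at π₂ π₁ τ₂ τ₁ ρ ρ≤d (λ s s≤d s≢ρ x → sym (agree s s≤d s≢ρ x)) (λ same → differ (sym ∘ same))

outside-agree : ∀ {d} (π₁ π₂ : Permutation′ (suc d)) (τ₁ τ₂ : Permutation′ d) (T : OSP (suc d)) {r} →
  UniqueOutside (ch π₁ τ₁) (ch π₂ τ₂) T → rank T ≡ r → ∀ t → t ≤ d → t ≢ r → SameAt π₁ τ₁ π₂ τ₂ t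
outside-agree π₁ π₂ τ₁ τ₂ T {r} (_ , _ , unique) rankT t t≤d t≢r x with Tblk π₁ τ₁ t x ≟ Tblk π₂ τ₂ t x
... | yes e = e
... | no ne = ⊥-elim (t≢r (begin
  t                  ≡⟨ sym (rank-at-level π₁ τ₁ t (𝒯 π₁ τ₁ t) (λ _ → refl) t≤d) ⟩
  rank (𝒯 π₁ τ₁ t)   ≡⟨ rank-cong (𝒯 π₁ τ₁ t) T (unique (𝒯 π₁ τ₁ t) (𝒯∈ch π₁ τ₁ t t≤d) outside) ⟩
  rank T             ≡⟨ rankT ⟩
  r                  ∎))
  where
  open ≡-Reasoning
  outside : ¬ ch π₂ τ₂ (𝒯 π₁ τ₁ t)
  outside inside = ne (level-in-other π₁ π₂ τ₁ τ₂ t t≤d inside x)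

outside-differ : ∀ {d} (π₁ π₂ : Permutation′ (suc d)) (τ₁ τ₂ : Permutation′ d) (T : OSP (suc d)) {r} →
  UniqueOutside (ch π₁ τ₁) (ch π₂ τ₂) T → rank T ≡ r → ¬ SameAt π₁ τ₁ π₂ τ₂ r
outside-differ π₁ π₂ τ₁ τ₂ T ((s , s≤d , T≡) , T∉ , _) refl same =
  T∉ (s , s≤d , λ x → trans (T≡ x) (subst (SameAt π₁ τ₁ π₂ τ₂) rankT≡s same x))
  where
  rankT≡s : rank T ≡ s
  rankT≡s = rank-at-level π₁ τ₁ s T T≡ s≤d

cuts-from-blocks : ∀ {d} (π : Permutation′ (suc d)) (C C′ : Fin d → Bool) →
  (∀ x → cutsBefore C (pos π x) ≡ cutsBefore C′ (pos π x)) → ∀ j → C j ≡ C′ j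
cuts-from-blocks π C C′ same = cutsBefore-injective C C′ λ p p≤d →
  subst (λ q → cutsBefore C q ≡ cutsBefore C′ q) (pos-elemAt π p≤d) (same (elemAt π p))

-- Level cut sets agreeing at every level t ≠ r relate the labels by SwapOrFix r
-- (levels beyond d keep no bar at all).
labels-SwapOrFix : ∀ {d} (τ₁ τ₂ : Permutation′ d) r →
  (∀ t → t ≤ d → t ≢ r → ∀ j → cutsAt τ₁ t j ≡ cutsAt τ₂ t j) → ∀ j → SwapOrFix r (val τ₁ j) (val τ₂ j)
labels-SwapOrFix {d} τ₁ τ₂ r same j = threshold-SwapOrFix r _ _ thresholds
  where
  thresholds : ∀ t → t ≢ r → (t <ᵇ val τ₁ j) ≡ (t <ᵇ val τ₂ j)
  thresholds t t≢r with t ≤? d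
  ... | yes t≤d = same t t≤d t≢r j
  ... | no t≰d  = trans (<ᵇ-false (≤-trans (val≤ τ₁ j) d≤t)) (sym (<ᵇ-false (≤-trans (val≤ τ₂ j) d≤t)))
    where
    d≤t : d ≤ t
    d≤t = <⇒≤ (≰⇒> t≰d)

SwapOrFix-of-swapℕ : ∀ {n k} (f g : Fin n → ℕ) → (∀ j → g j ≡ swapℕ k (suc k) (f j)) →
  ∀ j → SwapOrFix k (f j) (g j)
SwapOrFix-of-swapℕ {k = k} f g g≡ j = subst (SwapOrFix k (f j)) (sym (g≡ j)) (swapℕ-SwapOrFix k (f j))

cutsAt-one : ∀ {d} (τ : Permutation′ d) i → val τ i ≡ 1 → ∀ j → cutsAt τ 1 j ≡ not (does (j FP.≟ i))
cutsAt-one τ i vi≡1 j with j FP.≟ i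
... | yes refl = <ᵇ-false {1} (≤-reflexive vi≡1)
... | no j≢i   = <ᵇ-true (≤∧≢⇒< (val≥1 j) (λ 1≡vj → j≢i (val-injective τ (trans (sym 1≡vj) (sym vi≡1)))))
  where
  val≥1 : ∀ j → 1 ≤ val τ j
  val≥1 j = s≤s z≤n

cutsAt-one-gap : ∀ {d} (τ : Permutation′ d) i → val τ i ≡ 1 → ∀ j → cutsAt τ 1 j ≡ false → j ≡ i
cutsAt-one-gap τ i vi≡1 j gap with j FP.≟ i | cutsAt-one τ i vi≡1 j
... | yes j≡i | _    = j≡i
... | no _    | kept = ⊥-elim (true≢false (trans (sym kept) gap))

cutsAt-label-one : ∀ {d} (τ : Permutation′ d) i → val τ i ≡ 1 → ∀ t → 1 ≤ t → cutsAt τ t i ≡ false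
cutsAt-label-one τ i vi≡1 t 1≤t = <ᵇ-false (subst (_≤ t) (sym vi≡1) 1≤t)

-- If positions p < q lie in block i at level 1, bar i is the bar labelled 1:
-- the bar p between them is a gap, hence the unique bar labelled 1; all bars
-- before it are kept, so p = i.
label-one-between : ∀ {d} (τ : Permutation′ d) (i : Fin d) {p q} → p < q → q ≤ d →
  cutsBefore (cutsAt τ 1) p ≡ toℕ i → cutsBefore (cutsAt τ 1) q ≡ toℕ i → val τ i ≡ 1
label-one-between {d} τ i {p} {q} p<q q≤d p∈i q∈i = subst (λ j → val τ j ≡ 1) (sym i≡b) vb≡1
  where
  K : Fin d → Bool
  K = cutsAt τ 1
  p<d : p < d
  p<d = <-≤-trans p<q q≤d
  b : Fin d
  b = fromℕ< p<d
  toℕb : toℕ b ≡ p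
  toℕb = FP.toℕ-fromℕ< p<d
  label≡1 : ∀ {j} → K j ≡ false → val τ j ≡ 1
  label≡1 {j} gap = ≤-antisym (<ᵇ-false⁻¹ gap) (s≤s z≤n)
  vb≡1 : val τ b ≡ 1
  vb≡1 = label≡1 (cutsBefore-flat K b (≤-reflexive (sym toℕb)) (subst (_< q) (sym toℕb) p<q) (trans p∈i (sym q∈i)))
  kept-before : ∀ j → toℕ j < p → K j ≡ true
  kept-before j j<p with K j in Kj
  ... | true  = refl
  ... | false = ⊥-elim (<-irrefl (trans (cong toℕ (val-injective τ (trans (label≡1 Kj) (sym vb≡1)))) toℕb) j<p)
  i≡b : i ≡ b
  i≡b = FP.toℕ-injective (trans (sym p∈i) (trans (cutsBefore-allCuts K p (<⇒≤ p<d) kept-before) (sym toℕb)))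

label-one : ∀ {d} (π : Permutation′ (suc d)) (τ : Permutation′ d) (i : Fin d) x y → x ≢ y →
  Tblk π τ 1 x ≡ toℕ i → Tblk π τ 1 y ≡ toℕ i → val τ i ≡ 1
label-one π τ i x y x≢y x∈i y∈i with <-cmp (pos π x) (pos π y)
... | tri< px<py _ _ = label-one-between τ i px<py (pos≤ π y) x∈i y∈i
... | tri≈ _ px≡py _ = ⊥-elim (x≢y (trans (sym (elemAt-pos π x)) (trans (cong (elemAt π) px≡py) (elemAt-pos π y))))
... | tri> _ _ py<px = label-one-between τ i py<px (pos≤ π x) y∈i x∈i

-- (1) If two chains agree at every level except r > 0, their sequences coincide
-- (level 0 records positions) and the labels differ by the transposition (r,r+1).
diamond : ∀ {d} (π₁ π₂ : Permutation′ (suc d)) (τ₁ τ₂ : Permutation′ d) r → 0 < r →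
  (∀ t → t ≤ d → t ≢ r → SameAt π₁ τ₁ π₂ τ₂ t) → ¬ SameAt π₁ τ₁ π₂ τ₂ r →
  (∀ x → π₁ ⟨$⟩ʳ x ≡ π₂ ⟨$⟩ʳ x) × (∀ j → val τ₂ j ≡ swapℕ r (suc r) (val τ₁ j))
diamond {d} π₁ π₂ τ₁ τ₂ r 0<r agree differ = FP.toℕ-injective ∘ pos≡ , τ-swap
  where
  pos≡ : ∀ x → pos π₁ x ≡ pos π₂ x
  pos≡ x = trans (sym (Tblk-zero π₁ τ₁ x))
    (trans (agree 0 z≤n (λ 0≡r → <-irrefl 0≡r 0<r) x) (Tblk-zero π₂ τ₂ x))
  same-cuts : ∀ t → t ≤ d → t ≢ r → ∀ j → cutsAt τ₁ t j ≡ cutsAt τ₂ t j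
  same-cuts t t≤d t≢r = cuts-from-blocks π₁ _ _ λ x →
    trans (agree t t≤d t≢r x) (cong (cutsBefore (cutsAt τ₂ t)) (sym (pos≡ x)))
  labels-differ : ¬ (∀ j → val τ₁ j ≡ val τ₂ j)
  labels-differ same = differ λ x → trans (cutsBefore-cong (λ j → cong (r <ᵇ_) (same j)) (pos π₁ x))
                                          (cong (cutsBefore (cutsAt τ₂ r)) (pos≡ x))
  τ-swap : ∀ j → val τ₂ j ≡ swapℕ r (suc r) (val τ₁ j)
  τ-swap = SwapOrFix-transposition (val τ₁) (val τ₂) (val-injective τ₁) (val-injective τ₂)
    (labels-SwapOrFix τ₁ τ₂ r same-cuts) labels-differ

bottom-flip : ∀ {d} (π₁ π₂ : Permutation′ (suc d)) (τ₁ τ₂ : Permutation′ d) →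
  (∀ t → t ≤ d → t ≢ 0 → SameAt π₁ τ₁ π₂ τ₂ t) → ¬ SameAt π₁ τ₁ π₂ τ₂ 0 →
  ∀ (i : Fin d) x y → x ≢ y → Tblk π₁ τ₁ 1 x ≡ toℕ i → Tblk π₁ τ₁ 1 y ≡ toℕ i →
  (∀ j → τ₁ ⟨$⟩ʳ j ≡ τ₂ ⟨$⟩ʳ j) × val τ₁ i ≡ 1 × val τ₂ i ≡ 1
  × (∀ z → val π₂ z ≡ swapℕ (suc (toℕ i)) (suc (suc (toℕ i))) (val π₁ z))
bottom-flip {d} π₁ π₂ τ₁ τ₂ agree differ i x y x≢y x∈i y∈i = τ≡ , v₁ , v₂ , π-swap
  where
  level-one : SameAt π₁ τ₁ π₂ τ₂ 1
  level-one = agree 1 (≤-<-trans z≤n (FP.toℕ<n i)) (λ ())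
  v₁ : val τ₁ i ≡ 1
  v₁ = label-one π₁ τ₁ i x y x≢y x∈i y∈i
  v₂ : val τ₂ i ≡ 1
  v₂ = label-one π₂ τ₂ i x y x≢y (trans (sym (level-one x)) x∈i) (trans (sym (level-one y)) y∈i)
  -- level 1 only merges positions i and i+1, so each element keeps or crosses bar i
  moved : ∀ z → SwapOrFix (toℕ i) (pos π₁ z) (pos π₂ z)
  moved z = cutsBefore-oneGap (cutsAt τ₂ 1) i (cutsAt-one-gap τ₂ i v₂) (pos≤ π₁ z) (pos≤ π₂ z)
    (trans (cutsBefore-cong (λ j → trans (cutsAt-one τ₂ i v₂ j) (sym (cutsAt-one τ₁ i v₁ j))) (pos π₁ z))
           (level-one z))
  -- at levels t ≥ 1 bar i is a gap, so crossing it changes no block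
  same-cuts : ∀ t → t ≤ d → t ≢ 0 → ∀ j → cutsAt τ₁ t j ≡ cutsAt τ₂ t j
  same-cuts t t≤d t≢0 = cuts-from-blocks π₁ _ _ λ z → trans (agree t t≤d t≢0 z)
    (sym (cutsBefore-SwapOrFix (cutsAt τ₂ t) i (cutsAt-label-one τ₂ i v₂ t (n≢0⇒n>0 t≢0)) (moved z)))
  τ≡ : ∀ j → τ₁ ⟨$⟩ʳ j ≡ τ₂ ⟨$⟩ʳ j
  τ≡ j with labels-SwapOrFix τ₁ τ₂ 0 same-cuts j
  ... | fixed e = FP.toℕ-injective (suc-injective e)
  ... | up () _
  ... | down _ ()
  positions-differ : ¬ (∀ z → val π₁ z ≡ val π₂ z)
  positions-differ same = differ λ z →
    trans (Tblk-zero π₁ τ₁ z) (trans (suc-injective (same z)) (sym (Tblk-zero π₂ τ₂ z)))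
  π-swap : ∀ z → val π₂ z ≡ swapℕ (suc (toℕ i)) (suc (suc (toℕ i))) (val π₁ z)
  π-swap = SwapOrFix-transposition (val π₁) (val π₂) (val-injective π₁) (val-injective π₂)
    (SwapOrFix-suc ∘ moved) positions-differ

diamond-levels : ∀ {d} (π₁ π₂ : Permutation′ (suc d)) (τ₁ τ₂ : Permutation′ d) r → 1 ≤ r → r < d →
  (∀ x → π₁ ⟨$⟩ʳ x ≡ π₂ ⟨$⟩ʳ x) → (∀ j → val τ₂ j ≡ swapℕ r (suc r) (val τ₁ j)) →
  (∀ s → s ≤ d → s ≢ r → SameAt π₁ τ₁ π₂ τ₂ s) × ¬ SameAt π₁ τ₁ π₂ τ₂ r
diamond-levels {d} π₁ π₂ τ₁ τ₂ (suc r′) _ r<d π≡ τ-swap = agree , differ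
  where
  r : ℕ
  r = suc r′
  pos≡ : ∀ x → pos π₁ x ≡ pos π₂ x
  pos≡ x = cong toℕ (π≡ x)
  agree : ∀ s → s ≤ d → s ≢ r → SameAt π₁ τ₁ π₂ τ₂ s
  agree s _ s≢r x = trans
    (cutsBefore-cong (λ j → SwapOrFix-threshold (SwapOrFix-of-swapℕ (val τ₁) (val τ₂) τ-swap j) s s≢r) (pos π₁ x))
    (cong (cutsBefore (cutsAt τ₂ s)) (pos≡ x))
  -- the bar labelled r by τ₁ is deleted at level r by τ₁ but kept by τ₂
  j₁ : Fin d
  j₁ = labelAt τ₁ r′ (<⇒≤ r<d)
  kept₂ : cutsAt τ₂ r j₁ ≡ true
  kept₂ = trans (cong (r <ᵇ_) (trans (τ-swap j₁)
                  (trans (cong (swapℕ r (suc r)) (val-labelAt τ₁ r′ (<⇒≤ r<d))) (swapℕ-k r))))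
                (<ᵇ-true (n<1+n r))
  differ : ¬ SameAt π₁ τ₁ π₂ τ₂ r
  differ same = true≢false (trans (sym kept₂) (trans (sym (same-cut j₁)) (proj₁ (proj₂ (cutsAt-step τ₁ r′ (<⇒≤ r<d))))))
    where
    same-cut : ∀ j → cutsAt τ₁ r j ≡ cutsAt τ₂ r j
    same-cut = cuts-from-blocks π₁ (cutsAt τ₁ r) (cutsAt τ₂ r) λ x →
      trans (same x) (cong (cutsBefore (cutsAt τ₂ r)) (sym (pos≡ x)))

flip-levels : ∀ {d} (π₁ π₂ : Permutation′ (suc d)) (τ₁ τ₂ : Permutation′ d) (i : Fin d) →
  (∀ j → τ₁ ⟨$⟩ʳ j ≡ τ₂ ⟨$⟩ʳ j) → val τ₁ i ≡ 1 →
  (∀ z → val π₂ z ≡ swapℕ (suc (toℕ i)) (suc (suc (toℕ i))) (val π₁ z)) →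
  (∀ s → s ≤ d → s ≢ 0 → SameAt π₁ τ₁ π₂ τ₂ s) × ¬ SameAt π₁ τ₁ π₂ τ₂ 0
flip-levels {d} π₁ π₂ τ₁ τ₂ i τ≡ v π-swap = agree , differ
  where
  moved : ∀ z → SwapOrFix (toℕ i) (pos π₁ z) (pos π₂ z)
  moved z = SwapOrFix-pred (SwapOrFix-of-swapℕ (val π₁) (val π₂) π-swap z)
  agree : ∀ s → s ≤ d → s ≢ 0 → SameAt π₁ τ₁ π₂ τ₂ s
  agree s _ s≢0 z = trans (cutsBefore-SwapOrFix (cutsAt τ₁ s) i (cutsAt-label-one τ₁ i v s (n≢0⇒n>0 s≢0)) (moved z))
    (cutsBefore-cong (λ j → cong (λ σj → s <ᵇ suc (toℕ σj)) (τ≡ j)) (pos π₂ z))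
  -- the element in position i moves to position i+1
  x : Fin (suc d)
  x = elemAt π₁ (toℕ i)
  at-i : pos π₁ x ≡ toℕ i
  at-i = pos-elemAt π₁ (FP.toℕ≤n i)
  differ : ¬ SameAt π₁ τ₁ π₂ τ₂ 0
  differ same = 1+n≢n (begin
    suc (suc (toℕ i))                                       ≡⟨ sym (swapℕ-k (suc (toℕ i))) ⟩
    swapℕ (suc (toℕ i)) (suc (suc (toℕ i))) (suc (toℕ i))   ≡⟨ cong (λ p → swapℕ (suc (toℕ i)) (suc (suc (toℕ i))) (suc p)) (sym at-i) ⟩
    swapℕ (suc (toℕ i)) (suc (suc (toℕ i))) (val π₁ x)      ≡⟨ sym (π-swap x) ⟩
    suc (pos π₂ x)                                          ≡⟨ cong suc (sym (trans (sym (Tblk-zero π₁ τ₁ x)) (trans (same x) (Tblk-zero π₂ τ₂ x)))) ⟩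
    suc (pos π₁ x)                                          ≡⟨ cong suc at-i ⟩
    suc (toℕ i)                                             ∎)
    where open ≡-Reasoning

lemma4p22 : (d : ℕ) →
    ((π₁ π₂ : Permutation′ (suc d)) (τ₁ τ₂ : Permutation′ d)
      (T T' : OSP (suc d)) (r : ℕ) →
      UniqueOutside (ch π₁ τ₁) (ch π₂ τ₂) T →
      UniqueOutside (ch π₂ τ₂) (ch π₁ τ₁) T' →
      rank T ≡ r → rank T' ≡ r → r < d →
      (0 < r →
        (∀ x → π₁ ⟨$⟩ʳ x ≡ π₂ ⟨$⟩ʳ x)
        × (∀ j → val τ₂ j ≡ swapℕ r (suc r) (val τ₁ j)))
      × (r ≡ 0 →
        ∀ (i : Fin d) (x y : Fin (suc d)) → x ≢ y →
        Tblk π₁ τ₁ 1 x ≡ toℕ i → Tblk π₁ τ₁ 1 y ≡ toℕ i →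
        (∀ j → τ₁ ⟨$⟩ʳ j ≡ τ₂ ⟨$⟩ʳ j)
        × val τ₁ i ≡ 1 × val τ₂ i ≡ 1
        × (∀ z → val π₂ z ≡ swapℕ (suc (toℕ i)) (suc (suc (toℕ i))) (val π₁ z))))
    × ((π₁ π₂ : Permutation′ (suc d)) (τ₁ τ₂ : Permutation′ d) →
      ((Σ ℕ λ r → (1 ≤ r) × (r < d)
          × (∀ x → π₁ ⟨$⟩ʳ x ≡ π₂ ⟨$⟩ʳ x)
          × (∀ j → val τ₂ j ≡ swapℕ r (suc r) (val τ₁ j)))
       ⊎ (Σ (Fin d) λ i → (∀ j → τ₁ ⟨$⟩ʳ j ≡ τ₂ ⟨$⟩ʳ j)
          × val τ₁ i ≡ 1
          × (∀ z → val π₂ z ≡ swapℕ (suc (toℕ i)) (suc (suc (toℕ i))) (val π₁ z)))) →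
      IsMaximalChain (ch π₁ τ₁) × IsMaximalChain (ch π₂ τ₂)
        × DifferInExactlyOne (ch π₁ τ₁) (ch π₂ τ₂))
lemma4p22 d =
  -- The unique element T of ch₁ ∖ ch₂ has rank r, the chains agree at every
  -- other level, and (1) resp. (2) reads off the moves.
  (λ π₁ π₂ τ₁ τ₂ T _ r T-only _ rankT _ _ →
      (λ 0<r → diamond π₁ π₂ τ₁ τ₂ r 0<r
                 (outside-agree π₁ π₂ τ₁ τ₂ T T-only rankT) (outside-differ π₁ π₂ τ₁ τ₂ T T-only rankT))
    , (λ r≡0 → bottom-flip π₁ π₂ τ₁ τ₂
                 (outside-agree π₁ π₂ τ₁ τ₂ T T-only (trans rankT r≡0))
                 (outside-differ π₁ π₂ τ₁ τ₂ T T-only (trans rankT r≡0))))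
  -- Each move changes exactly one level, so the chains differ in exactly one element.
  , λ where
    π₁ π₂ τ₁ τ₂ (inj₁ (r , 1≤r , r<d , π≡ , τ-swap)) →
      let (agree , differ) = diamond-levels π₁ π₂ τ₁ τ₂ r 1≤r r<d π≡ τ-swap
      in maximal π₁ τ₁ , maximal π₂ τ₂ , differInOne-at π₁ π₂ τ₁ τ₂ r (<⇒≤ r<d) agree differ
    π₁ π₂ τ₁ τ₂ (inj₂ (i , τ≡ , v , π-swap)) →
      let (agree , differ) = flip-levels π₁ π₂ τ₁ τ₂ i τ≡ v π-swap
      in maximal π₁ τ₁ , maximal π₂ τ₂ , differInOne-at π₁ π₂ τ₁ τ₂ 0 z≤n agree differ
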